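{- Let $T[1,n]$ be a text whose last character $T[n]=\$$ occurs nowhere else in $T$, and let $Z[1,n']$ be its LZ-End parsing. Then all phrases $Z[1],\dots,Z[n']$ are pairwise different strings.
   Context: LZ-End parsing of $T[1,n]$: a sequence $Z[1,n']$ of phrases with $T=Z[1]\cdots Z[n']$, built as follows: having processed $T[1,i-1]$ into $Z[1,p-1]$, find the longest prefix $T[i,i'-1]$ of $T[i,n]$ that is a suffix of $Z[1]Z[2]\cdots Z[q]$ for some $q<p$, set $Z[p]=T[i,i']$ and continue with $i=i'+1$. -}

module Defs where

open import Level using (Level)
open import Data.Nat using (ℕ; _≤_; _<_)
open import Data.List using (List; []; _∷_; _++_; _∷ʳ_; concat; take; length)
open import Data.Product using (Σ; ∃; _×_)
open import Relation.Binary.PropositionalEquality using (_≡_)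

private variable a : Level

IsPrefix : {A : Set a} → List A → List A → Set a
IsPrefix {A = A} u v = Σ (List A) λ r → u ++ r ≡ v

IsSuffix : {A : Set a} → List A → List A → Set a
IsSuffix {A = A} u v = Σ (List A) λ l → l ++ u ≡ v

-- Given the already produced phrases prev = Z[1..p-1], u is a suffix of
-- Z[1]⋯Z[q] for some q < p (i.e. q ≤ p-1 = length prev; q = 0 is the empty text).
EndsAPhrasePrefix : {A : Set a} → List (List A) → List A → Set a
EndsAPhrasePrefix prev u = ∃ λ q → q ≤ length prev × IsSuffix u (concat (take q prev))

-- LZEndFrom prev rest Z : continuing the LZ-End parsing, with phrases prev
-- already produced, the remaining text rest is parsed into the phrases Z.
data LZEndFrom {A : Set a} (prev : List (List A)) : List A → List (List A) → Set a where
  done : LZEndFrom prev [] []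
  -- Z[p] = w c, where w is the longest prefix of the remaining text that is a
  -- suffix of Z[1]⋯Z[q] for some q < p, and c is the next character.
  step : ∀ (w : List A) (c : A) (rest' : List A) (Z : List (List A)) →
         EndsAPhrasePrefix prev w →
         (∀ u → IsPrefix u (w ++ c ∷ rest') → EndsAPhrasePrefix prev u → length u ≤ length w) →
         LZEndFrom (prev ∷ʳ (w ++ c ∷ [])) rest' Z →
         LZEndFrom prev (w ++ c ∷ rest') ((w ++ c ∷ []) ∷ Z)
  -- Degenerate final phrase: the whole (nonempty) remaining text is itself a
  -- suffix of some Z[1]⋯Z[q], so there is no next character to append.
  last : ∀ (x : A) (xs : List A) →
         EndsAPhrasePrefix prev (x ∷ xs) →
         LZEndFrom prev (x ∷ xs) ((x ∷ xs) ∷ [])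

IsLZEndParsing : {A : Set a} → List A → List (List A) → Set a
IsLZEndParsing T Z = LZEndFrom [] T Z

-- We follow the parsing phrase by phrase and maintain the
-- invariant that the phrases still to be produced are pairwise distinct and
-- that none of them equals an already produced phrase.  A new phrase is
-- always fresh:
--   * an ordinary phrase w c cannot equal an earlier phrase Z[q], because then
--     w c would be a suffix of Z[1]⋯Z[q] and a prefix of the remaining text,
--     contradicting the maximality of w (it is one symbol longer);
--   * the degenerate final phrase is the whole remaining text, so it ends
--     with $; if it equalled an earlier phrase, $ would occur in the already
--     parsed text, which is a prefix of T′, contradicting $ ∉ T′.
module Submission where

open import Defs
open import Data.List using (List; []; _∷_; _++_; _∷ʳ_; [_]; concat; length)
open import Data.List.Properties using (++-assoc; ++-identityʳ; length-++; concat-++; ∷ʳ-injective)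
open import Data.List.Membership.Propositional using (_∈_; _∉_)
open import Data.List.Membership.Propositional.Properties using (∈-concat⁺′; ∈-++⁺ˡ; ∈-++⁺ʳ)
open import Data.List.Relation.Unary.All as All using (All; []; _∷_)
open import Data.List.Relation.Unary.Any using (here; there)
open import Data.List.Relation.Unary.AllPairs using ([]; _∷_)
open import Data.List.Relation.Unary.Unique.Propositional using (Unique)
open import Data.Nat using (suc; _≤_; s≤s; z≤n)
open import Data.Nat.Properties using (m+1+n≰m)
open import Data.Product using (_×_; _,_; ∃₂)
open import Relation.Binary.PropositionalEquality using (_≡_; _≢_; refl; sym; trans; cong; subst; module ≡-Reasoning)
open import Level using (Level)

module _ {a : Level} {A : Set a} where

  -- Every produced phrase Z[q] is a suffix of Z[1]⋯Z[q], so it qualifies as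
  -- a candidate for the copied part of a later phrase.
  ∈⇒endsAPhrasePrefix : ∀ {z : List A} (prev : List (List A)) →
                        z ∈ prev → EndsAPhrasePrefix prev z
  ∈⇒endsAPhrasePrefix (p ∷ ps) (here refl) = 1 , s≤s z≤n , [] , sym (++-identityʳ p)
  ∈⇒endsAPhrasePrefix (p ∷ ps) (there z∈ps) with ∈⇒endsAPhrasePrefix ps z∈ps
  ... | q , q≤ , l , l++z≡ = suc q , s≤s q≤ , p ++ l , trans (++-assoc p l _) (cong (p ++_) l++z≡)

  -- An ordinary phrase w c never repeats an earlier phrase: otherwise it would
  -- be a copyable prefix of the remaining text longer than the maximal one, w.
  stepPhraseFresh : ∀ (prev : List (List A)) (w : List A) (c : A) (rest : List A) →
                    (∀ u → IsPrefix u (w ++ c ∷ rest) → EndsAPhrasePrefix prev u → length u ≤ length w) →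
                    (w ++ [ c ]) ∉ prev
  stepPhraseFresh prev w c rest maximal wc∈prev =
    m+1+n≰m (length w) (subst (_≤ length w) (length-++ w) wc-short)
    where
    wc-short : length (w ++ [ c ]) ≤ length w
    wc-short = maximal (w ++ [ c ]) (rest , ++-assoc w [ c ] rest)
                       (∈⇒endsAPhrasePrefix prev wc∈prev)

  snocView : (x : A) (xs : List A) → ∃₂ λ ys y → x ∷ xs ≡ ys ∷ʳ y
  snocView x [] = [] , x , refl
  snocView x (x′ ∷ xs) with snocView x′ xs
  ... | ys , y , xs≡ = x ∷ ys , y , cong (x ∷_) xs≡

  splitAtLast : ∀ (T′ P ys : List A) (d y : A) →
                P ++ (ys ∷ʳ y) ≡ T′ ∷ʳ d → y ≡ d × IsPrefix P T′
  splitAtLast T′ P ys d y text≡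
    with ∷ʳ-injective (P ++ ys) T′ (trans (++-assoc P ys [ y ]) text≡)
  ... | P++ys≡T′ , y≡d = y≡d , ys , P++ys≡T′

  -- The degenerate final phrase is the whole remaining text, which ends with
  -- the unique $; hence it cannot equal an earlier phrase.
  lastPhraseFresh : ∀ (T′ : List A) (d : A) → d ∉ T′ →
                    (prev : List (List A)) (x : A) (xs : List A) →
                    concat prev ++ x ∷ xs ≡ T′ ∷ʳ d → (x ∷ xs) ∉ prev
  lastPhraseFresh T′ d d∉T′ prev x xs text≡ u∈prev with snocView x xs
  ... | ys , y , u≡ys∷ʳy
    with splitAtLast T′ (concat prev) ys d y (subst (λ u → concat prev ++ u ≡ T′ ∷ʳ d) u≡ys∷ʳy text≡)
  ... | refl , _ , prev++r≡T′ =
    d∉T′ (subst (d ∈_) prev++r≡T′ (∈-++⁺ˡ (∈-concat⁺′ y∈u u∈prev)))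
    where
    y∈u : y ∈ x ∷ xs
    y∈u = subst (y ∈_) (sym u≡ys∷ʳy) (∈-++⁺ʳ ys (here refl))

  concat-∷ʳ-++ : ∀ (prev : List (List A)) (w : List A) (c : A) (rest : List A) →
                 concat (prev ∷ʳ (w ++ [ c ])) ++ rest ≡ concat prev ++ (w ++ c ∷ rest)
  concat-∷ʳ-++ prev w c rest = begin
    concat (prev ∷ʳ (w ++ [ c ])) ++ rest   ≡⟨ cong (_++ rest) (sym (concat-++ prev [ w ++ [ c ] ])) ⟩
    (concat prev ++ concat [ w ++ [ c ] ]) ++ rest
                                            ≡⟨ ++-assoc (concat prev) _ rest ⟩
    concat prev ++ (concat [ w ++ [ c ] ] ++ rest)
                                            ≡⟨ cong (λ s → concat prev ++ (s ++ rest)) (++-assoc w [ c ] []) ⟩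
    concat prev ++ ((w ++ c ∷ []) ++ rest)  ≡⟨ cong (concat prev ++_) (++-assoc w [ c ] rest) ⟩
    concat prev ++ (w ++ c ∷ rest)          ∎
    where open ≡-Reasoning

  phrasesFresh : ∀ (T′ : List A) (d : A) → d ∉ T′ →
                 ∀ {prev rest Z} → LZEndFrom prev rest Z → concat prev ++ rest ≡ T′ ∷ʳ d →
                 Unique Z × All (_∉ prev) Z
  phrasesFresh T′ d d∉T′ done _ = [] , []
  phrasesFresh T′ d d∉T′ {prev} (step w c rest Z _ maximal parse) text≡
    with phrasesFresh T′ d d∉T′ parse (trans (concat-∷ʳ-++ prev w c rest) text≡)
  ... | unique , fresh =
      All.map differs fresh ∷ unique
    , stepPhraseFresh prev w c rest maximal ∷ All.map (λ z∉ z∈ → z∉ (∈-++⁺ˡ z∈)) fresh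
    where
    differs : ∀ {z} → z ∉ prev ∷ʳ (w ++ [ c ]) → w ++ [ c ] ≢ z
    differs z∉ refl = z∉ (∈-++⁺ʳ prev (here refl))
  phrasesFresh T′ d d∉T′ {prev} (last x xs _) text≡ =
    [] ∷ [] , lastPhraseFresh T′ d d∉T′ prev x xs text≡ ∷ []

lemma4p4 : {a : Level} {A : Set a} (T′ : List A) (dollar : A) (Z : List (List A)) →
           dollar ∉ T′ →
           IsLZEndParsing (T′ ∷ʳ dollar) Z →
           Unique Z
lemma4p4 T′ dollar Z dollar∉T′ parsing with phrasesFresh T′ dollar dollar∉T′ parsing refl
... | unique , _ = unique
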